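{- Let $\mathcal{C}$ be a binary Boolean VCSP instance on $n$ variables whose constraint graph is a tree. Then every directed path in the fitness graph $G_\mathcal{C}$ has length (number of edges) at most $\binom{n}{2}+n$.
   Context: Variables are indexed by $[n]$, each with domain $\{0,1\}$; points are $x\in\{0,1\}^n$. A (valued) constraint with scope $S\subseteq[n]$ is a function $C_S:\{0,1\}^S\to\mathbb{Z}$. A binary Boolean VCSP instance is a finite set of constraints with scopes of size at most $2$, at most one per scope; it implements $f(x)=\sum_{C_S\in\mathcal{C}}C_S(x[S])$. Its fitness graph $G_\mathcal{C}$ has vertex set $\{0,1\}^n$ and a directed edge $(x,y)$ iff $x,y$ differ in exactly one coordinate and $f(y)>f(x)$. Its constraint graph has vertex set $[n]$ and an edge $\{i,j\}$ iff $\mathcal{C}$ contains a binary constraint with scope $\{i,j\}$ that is not identically zero. -}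

module Defs where

open import Data.Bool using (Bool; true; false)
open import Data.Fin using (Fin; _<_)
open import Data.Integer as ℤ using (ℤ; 0ℤ; _+_)
open import Data.List using (List; []; _∷_; _++_; [_]; length; map; foldr; allFin; filter)
open import Data.List.Relation.Unary.Linked using (Linked)
open import Data.List.Relation.Unary.Unique.Propositional using (Unique)
open import Data.Nat as ℕ using (ℕ)
open import Data.Product using (Σ; ∃; _×_; _,_)
open import Data.Sum using (_⊎_)
open import Relation.Binary.PropositionalEquality using (_≡_; _≢_)
open import Relation.Binary.Construct.Closure.ReflexiveTransitive using (Star)
open import Relation.Nullary using (¬_)

-- Points of the Boolean hypercube {0,1}^n (false = 0, true = 1).
Point : ℕ → Set
Point n = Fin n → Bool

sumℤ : List ℤ → ℤ
sumℤ = foldr _+_ 0ℤ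

-- There is at most one
-- constraint per scope of size ≤ 2; an absent constraint is represented by
-- the identically-zero function (which contributes nothing to f and no edge
-- to the constraint graph).
--   nullary        : the constraint with empty scope (a constant)
--   unary i        : the constraint with scope {i}
--   binary i j     : the constraint with scope {i,j}, used only when i < j
--                    (arguments are the values of x_i and x_j, in that order);
--                    entries with ¬ (i < j) are ignored.
record VCSP (n : ℕ) : Set where
  field
    nullary : ℤ
    unary   : Fin n → Bool → ℤ
    binary  : Fin n → Fin n → Bool → Bool → ℤ

open VCSP public

fitness : ∀ {n} → VCSP n → Point n → ℤ
fitness {n} C x =
  nullary C
  + sumℤ (map (λ i → unary C i (x i)) (allFin n))
  + sumℤ (map (λ i → sumℤ (map (λ j → pairTerm i j) (allFin n))) (allFin n))
  where
  pairTerm : Fin n → Fin n → ℤ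
  pairTerm i j with Data.Fin._<?_ i j
  ... | Relation.Nullary.yes _ = binary C i j (x i) (x j)
  ... | Relation.Nullary.no  _ = 0ℤ

DifferInOne : ∀ {n} → Point n → Point n → Set
DifferInOne {n} x y = Σ (Fin n) λ i → (x i ≢ y i) × (∀ j → j ≢ i → x j ≡ y j)

FitnessEdge : ∀ {n} → VCSP n → Point n → Point n → Set
FitnessEdge C x y = DifferInOne x y × (fitness C x ℤ.< fitness C y)

OrderedEdge : ∀ {n} → VCSP n → Fin n → Fin n → Set
OrderedEdge C i j = (i < j) × ∃ λ a → ∃ λ b → binary C i j a b ≢ 0ℤ

Adj : ∀ {n} → VCSP n → Fin n → Fin n → Set
Adj C i j = OrderedEdge C i j ⊎ OrderedEdge C j i

Connected : ∀ {n} → VCSP n → Set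
Connected C = ∀ u v → Star (Adj C) u v

IsCycle : ∀ {n} → VCSP n → Fin n → List (Fin n) → Set
IsCycle C v vs =
  Unique (v ∷ vs) × (2 ℕ.≤ length vs) × Linked (Adj C) (v ∷ vs ++ [ v ])

Acyclic : ∀ {n} → VCSP n → Set
Acyclic {n} C = ∀ (v : Fin n) (vs : List (Fin n)) → ¬ IsCycle C v vs

ConstraintGraphIsTree : ∀ {n} → VCSP n → Set
ConstraintGraphIsTree C = Connected C × Acyclic C

module Submission where

-- Let gain i x be the change of f when coordinate i of x is flipped. Flipping another coordinate k
-- lowers gain i by an interaction term that depends only on (x i , x k), vanishes unless i and k are
-- adjacent in the constraint graph, and changes sign whenever x i or x k flips. Along an improving
-- path, a flip of a variable u that is not its first flip follows an earlier flip of u after which the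
-- gain of u was negative, so in between the interaction of u with some neighbour turned favourable;
-- the flip is blamed on the last flip of that neighbour. Following blames backwards gives a chain of
-- flips ending at a first flip, whose variables form a non-backtracking walk, hence a path, in the
-- tree. Since paths in a tree are unique, a flip is determined by the unordered pair formed by its
-- variable and the variable of the first flip ending its chain, and there are C(n,2) + n such pairs.

open import Defs
open import Data.Bool as Bool using (Bool; true; false; not)
open import Data.Bool.Properties using (not-involutive; ¬-not)
open import Data.Empty using (⊥; ⊥-elim)
open import Data.Fin using (Fin; toℕ; fromℕ<)
import Data.Fin.Properties as Fin
open import Data.List using (List; []; _∷_; _++_; [_]; length; map; allFin; reverse)
open import Data.List.Membership.Propositional using (_∈_; _∉_)
open import Data.List.Membership.Propositional.Properties using (∈-allFin; ∈-∃++; ∈-++⁺ˡ; ∈-++⁺ʳ; ∈-++⁻)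
open import Data.List.Properties using (map-cong)
open import Data.List.Relation.Unary.All as All using ([])
open import Data.List.Relation.Unary.All.Properties using (¬Any⇒All¬)
open import Data.List.Relation.Unary.Any using (here; there)
open import Data.List.Relation.Unary.Linked as Linked using (Linked; []; [-]; _∷_)
open import Data.List.Relation.Unary.Unique.Propositional using (Unique; []; _∷_)
open import Data.List.Relation.Unary.Unique.Propositional.Properties using (allFin⁺)
open import Data.Nat as ℕ using (ℕ)
open import Data.Product as Product using (Σ; ∃; _×_; _,_; proj₁; proj₂)
open import Data.Sum as Sum using (_⊎_; inj₁; inj₂; [_,_]′)
open import Data.Unit using (⊤; tt)
open import Function using (_∘_; id)
open import Relation.Binary.Definitions using (DecidableEquality)
open import Relation.Binary.PropositionalEquality hiding ([_])
open import Relation.Nullary using (¬_; Dec; yes; no)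

module Sums where

  open import Data.Integer using (ℤ; 0ℤ; _+_)
  open import Data.Integer.Properties using (+-identityˡ; +-identityʳ; +-comm)

  module _ {A : Set} (g : A → ℤ) where

    sumℤ-map-≡0 : ∀ l → (∀ {j} → j ∈ l → g j ≡ 0ℤ) → sumℤ (map g l) ≡ 0ℤ
    sumℤ-map-≡0 []      _    = refl
    sumℤ-map-≡0 (j ∷ l) g≡0 = cong₂ _+_ (g≡0 (here refl)) (sumℤ-map-≡0 l (g≡0 ∘ there))

    sumℤ-map-single : ∀ {l i} → Unique l → i ∈ l → (∀ {j} → j ∈ l → j ≢ i → g j ≡ 0ℤ) →
                      sumℤ (map g l) ≡ g i
    sumℤ-map-single {j ∷ l} (j∉l ∷ _) (here refl) g≡0 = begin
      g j + sumℤ (map g l) ≡⟨ cong (g j +_) (sumℤ-map-≡0 l (λ k∈l → g≡0 (there k∈l) (All.lookup j∉l k∈l ∘ sym))) ⟩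
      g j + 0ℤ             ≡⟨ +-identityʳ (g j) ⟩
      g j                  ∎
      where open ≡-Reasoning
    sumℤ-map-single {j ∷ l} {i} (j∉l ∷ u) (there i∈l) g≡0 = begin
      g j + sumℤ (map g l) ≡⟨ cong (_+ sumℤ (map g l)) (g≡0 (here refl) (All.lookup j∉l i∈l)) ⟩
      0ℤ + sumℤ (map g l)  ≡⟨ +-identityˡ _ ⟩
      sumℤ (map g l)       ≡⟨ sumℤ-map-single u i∈l (g≡0 ∘ there) ⟩
      g i                  ∎
      where open ≡-Reasoning

    sumℤ-map-pair : ∀ {l i k} → Unique l → i ∈ l → k ∈ l → i ≢ k →
                    (∀ {j} → j ∈ l → j ≢ i → j ≢ k → g j ≡ 0ℤ) → sumℤ (map g l) ≡ g i + g k
    sumℤ-map-pair (_ ∷ _) (here refl) (here refl) i≢k _ = ⊥-elim (i≢k refl)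
    sumℤ-map-pair {j ∷ _} (j∉l ∷ u) (here refl) (there k∈l) _ g≡0 =
      cong (g j +_) (sumℤ-map-single u k∈l (λ j∈l → g≡0 (there j∈l) (All.lookup j∉l j∈l ∘ sym)))
    sumℤ-map-pair {j ∷ l} (j∉l ∷ u) (there i∈l) (here refl) _ g≡0 =
      trans (cong (g j +_) (sumℤ-map-single u i∈l (λ j′∈l j′≢i → g≡0 (there j′∈l) j′≢i (All.lookup j∉l j′∈l ∘ sym))))
            (+-comm (g j) _)
    sumℤ-map-pair {j ∷ l} (j∉l ∷ u) (there i∈l) (there k∈l) i≢k g≡0 =
      trans (cong (_+ sumℤ (map g l)) (g≡0 (here refl) (All.lookup j∉l i∈l) (All.lookup j∉l k∈l)))
            (trans (+-identityˡ _) (sumℤ-map-pair u i∈l k∈l i≢k (g≡0 ∘ there)))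

module Flips {n : ℕ} where

  flipAt : Point n → Fin n → Point n
  flipAt x k j with j Fin.≟ k
  ... | yes _ = not (x j)
  ... | no  _ = x j

  flipAt-self : ∀ x k → flipAt x k k ≡ not (x k)
  flipAt-self x k with k Fin.≟ k
  ... | yes _   = refl
  ... | no  k≢k = ⊥-elim (k≢k refl)

  flipAt-other : ∀ x {k j} → j ≢ k → flipAt x k j ≡ x j
  flipAt-other x {k} {j} j≢k with j Fin.≟ k
  ... | yes j≡k = ⊥-elim (j≢k j≡k)
  ... | no  _   = refl

  flipAt-cong : ∀ {x y} k → x ≗ y → flipAt x k ≗ flipAt y k
  flipAt-cong k x≗y j with j Fin.≟ k
  ... | yes _ = cong not (x≗y j)
  ... | no  _ = x≗y j

  flipAt-involutive : ∀ x k → flipAt (flipAt x k) k ≗ x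
  flipAt-involutive x k j = by-cases (j Fin.≟ k)
    where
    by-cases : Dec (j ≡ k) → flipAt (flipAt x k) k j ≡ x j
    by-cases (yes refl) = trans (flipAt-self (flipAt x j) j) (trans (cong not (flipAt-self x j)) (not-involutive (x j)))
    by-cases (no j≢k)   = trans (flipAt-other (flipAt x k) j≢k) (flipAt-other x j≢k)

  flipAt-comm : ∀ x {i k} → i ≢ k → flipAt (flipAt x k) i ≗ flipAt (flipAt x i) k
  flipAt-comm x {i} {k} i≢k j = by-cases (j Fin.≟ i) (j Fin.≟ k)
    where
    open ≡-Reasoning
    by-cases : Dec (j ≡ i) → Dec (j ≡ k) → flipAt (flipAt x k) i j ≡ flipAt (flipAt x i) k j
    by-cases (yes refl) (yes refl) = ⊥-elim (i≢k refl)
    by-cases (yes refl) (no j≢k) = begin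
      flipAt (flipAt x k) j j ≡⟨ flipAt-self (flipAt x k) j ⟩
      not (flipAt x k j)      ≡⟨ cong not (flipAt-other x j≢k) ⟩
      not (x j)               ≡⟨ flipAt-self x j ⟨
      flipAt x j j            ≡⟨ flipAt-other (flipAt x j) j≢k ⟨
      flipAt (flipAt x j) k j ∎
    by-cases (no j≢i) (yes refl) = begin
      flipAt (flipAt x j) i j ≡⟨ flipAt-other (flipAt x j) j≢i ⟩
      flipAt x j j            ≡⟨ flipAt-self x j ⟩
      not (x j)               ≡⟨ cong not (flipAt-other x j≢i) ⟨
      not (flipAt x i j)      ≡⟨ flipAt-self (flipAt x i) j ⟨
      flipAt (flipAt x i) j j ∎
    by-cases (no j≢i) (no j≢k) = begin
      flipAt (flipAt x k) i j ≡⟨ flipAt-other (flipAt x k) j≢i ⟩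
      flipAt x k j            ≡⟨ flipAt-other x j≢k ⟩
      x j                     ≡⟨ flipAt-other x j≢i ⟨
      flipAt x i j            ≡⟨ flipAt-other (flipAt x i) j≢k ⟨
      flipAt (flipAt x i) k j ∎

  AgreeOff : Fin n → Point n → Point n → Set
  AgreeOff i y z = ∀ j → j ≢ i → y j ≡ z j

  flipAt-agreeOff : ∀ y k → AgreeOff k (flipAt y k) y
  flipAt-agreeOff y k j = flipAt-other y

  flipAt-preserves-agreeOff : ∀ {i y z} k → AgreeOff i y z → AgreeOff i (flipAt y k) (flipAt z k)
  flipAt-preserves-agreeOff k agree j j≢i with j Fin.≟ k
  ... | yes _ = cong not (agree j j≢i)
  ... | no  _ = agree j j≢i

  differInOne⇒flipAt : ∀ {x y} → ((i , _) : DifferInOne x y) → y ≗ flipAt x i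
  differInOne⇒flipAt {x} {y} (i , xi≢yi , agree) j with j Fin.≟ i
  ... | yes refl = ¬-not (xi≢yi ∘ sym)
  ... | no  j≢i  = sym (agree j j≢i)

module Interaction {n : ℕ} (C : VCSP n) where

  open import Data.Integer using (ℤ; 0ℤ; _+_; _-_; -_; _≤_; _<_)
  open import Data.Integer.Properties as ℤ
    using (+-identityˡ; +-identityʳ; +-monoʳ-≤; ≤-reflexive; ≤-trans; <-irrefl; <-asym; <-≤-trans; ≮⇒≥;
           neg-mono-<; neg-mono-≤; _≟_; _<?_)
  open import Data.Integer.Tactic.RingSolver using (solve-∀)
  open import Relation.Nullary.Decidable using (_×-dec_)
  open Sums
  open Flips

  pairConstraint : Fin n → Fin n → Bool → Bool → ℤ
  pairConstraint i j a b with i Fin.<? j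
  ... | yes _ = binary C i j a b
  ... | no  _ = 0ℤ

  unarySum pairSum : Point n → ℤ
  unarySum x = sumℤ (map (λ i → unary C i (x i)) (allFin n))
  pairSum x = sumℤ (map (λ i → sumℤ (map (λ j → pairConstraint i j (x i) (x j)) (allFin n))) (allFin n))

  fitness-decomposition : ∀ x → fitness C x ≡ nullary C + unarySum x + pairSum x
  fitness-decomposition x =
    trans (proj₂ unfolded) (cong (nullary C + unarySum x +_) (sumℤ-cong λ i → sumℤ-cong (pairTerm≡ i)))
    where
    -- `fitness` sums a function local to its `where` block, which unification names here.
    unfolded : Σ (Fin n → Fin n → ℤ) λ pairTerm →
      fitness C x ≡ nullary C + unarySum x + sumℤ (map (λ i → sumℤ (map (pairTerm i) (allFin n))) (allFin n))
    unfolded = _ , refl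
    pairTerm≡ : ∀ i j → proj₁ unfolded i j ≡ pairConstraint i j (x i) (x j)
    pairTerm≡ i j with i Fin.<? j
    ... | yes _ = refl
    ... | no  _ = refl
    sumℤ-cong : ∀ {f g : Fin n → ℤ} → f ≗ g → sumℤ (map f (allFin n)) ≡ sumℤ (map g (allFin n))
    sumℤ-cong f≗g = cong sumℤ (map-cong f≗g (allFin n))

  fitness-cong : ∀ {x y} → x ≗ y → fitness C x ≡ fitness C y
  fitness-cong {x} {y} x≗y = begin
    fitness C x                           ≡⟨ fitness-decomposition x ⟩
    nullary C + unarySum x + pairSum x    ≡⟨ cong₂ (λ u p → nullary C + u + p) unary≡ pair≡ ⟩
    nullary C + unarySum y + pairSum y    ≡⟨ fitness-decomposition y ⟨
    fitness C y                           ∎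
    where
    open ≡-Reasoning
    unary≡ : unarySum x ≡ unarySum y
    unary≡ = cong sumℤ (map-cong (λ i → cong (unary C i) (x≗y i)) (allFin n))
    pair≡ : pairSum x ≡ pairSum y
    pair≡ = cong sumℤ (map-cong (λ i → cong sumℤ (map-cong (λ j → cong₂ (pairConstraint i j) (x≗y i) (x≗y j))
                                                            (allFin n))) (allFin n))

  gain : Fin n → Point n → ℤ
  gain i x = fitness C (flipAt x i) - fitness C x

  gain-cong : ∀ i {x y} → x ≗ y → gain i x ≡ gain i y
  gain-cong i x≗y = cong₂ _-_ (fitness-cong (flipAt-cong i x≗y)) (fitness-cong x≗y)

  edgeConstraint : Fin n → Fin n → Bool → Bool → ℤ
  edgeConstraint i k a b = pairConstraint i k a b + pairConstraint k i b a

  -- Flipping a coordinate k ≢ i lowers `gain i` by this amount (`gain-flipAt`).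
  interaction : Fin n → Fin n → Bool → Bool → ℤ
  interaction i k a b =
    (edgeConstraint i k (not a) b + edgeConstraint i k a (not b)) - (edgeConstraint i k a b + edgeConstraint i k (not a) (not b))

  Ignores : Fin n → (Point n → ℤ) → Set
  Ignores i h = ∀ {y z} → AgreeOff i y z → h y ≡ h z

  ignores-value : ∀ {i j} (H : Bool → ℤ) → j ≢ i → Ignores i (λ y → H (y j))
  ignores-value H j≢i agree = cong H (agree _ j≢i)

  ignores-pair : ∀ {i j l} (H : Bool → Bool → ℤ) → j ≢ i → l ≢ i → Ignores i (λ y → H (y j) (y l))
  ignores-pair H j≢i l≢i agree = cong₂ H (agree _ j≢i) (agree _ l≢i)

  pairAt : Fin n → Fin n → Point n → ℤ
  pairAt j l y = pairConstraint j l (y j) (y l)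

  module MixedDifference (x : Point n) {i k : Fin n} (i≢k : i ≢ k) where

    y₁ y₂ y₃ : Point n
    y₁ = flipAt x i
    y₂ = flipAt x k
    y₃ = flipAt y₁ k

    mixed : (Point n → ℤ) → ℤ
    mixed h = (h y₃ + h x) - (h y₁ + h y₂)

    mixed-ignores : ∀ h → Ignores i h ⊎ Ignores k h → mixed h ≡ 0ℤ
    mixed-ignores h (inj₁ ignores-i)
      rewrite ignores-i (flipAt-preserves-agreeOff k (flipAt-agreeOff x i)) | ignores-i (flipAt-agreeOff x i)
      = cancel (h (flipAt x k)) (h x)
      where
      cancel : ∀ a b → (a + b) - (b + a) ≡ 0ℤ
      cancel = solve-∀
    mixed-ignores h (inj₂ ignores-k)
      rewrite ignores-k (flipAt-agreeOff (flipAt x i) k) | ignores-k (flipAt-agreeOff x k)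
      = cancel (h (flipAt x i)) (h x)
      where
      cancel : ∀ a b → (a + b) - (a + b) ≡ 0ℤ
      cancel = solve-∀

    avoids-i-or-k : ∀ j → j ≢ i ⊎ j ≢ k
    avoids-i-or-k j with j Fin.≟ i
    ... | no  j≢i  = inj₁ j≢i
    ... | yes refl = inj₂ i≢k

    mixed-sumℤ : ∀ (G : Fin n → Point n → ℤ) l →
                 mixed (λ y → sumℤ (map (λ j → G j y) l)) ≡ sumℤ (map (λ j → mixed (G j)) l)
    mixed-sumℤ G []      = refl
    mixed-sumℤ G (j ∷ l) = trans (regroup (G j y₃) _ (G j x) _ (G j y₁) _ (G j y₂) _) (cong (mixed (G j) +_) (mixed-sumℤ G l))
      where
      regroup : ∀ a₃ s₃ a₀ s₀ a₁ s₁ a₂ s₂ →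
        ((a₃ + s₃) + (a₀ + s₀)) - ((a₁ + s₁) + (a₂ + s₂)) ≡ ((a₃ + a₀) - (a₁ + a₂)) + ((s₃ + s₀) - (s₁ + s₂))
      regroup = solve-∀

    mixed-unarySum : mixed unarySum ≡ 0ℤ
    mixed-unarySum = trans (mixed-sumℤ (λ j y → unary C j (y j)) (allFin n)) (sumℤ-map-≡0 _ (allFin n) (λ {j} _ → vanishes j))
      where
      vanishes : ∀ j → mixed (λ y → unary C j (y j)) ≡ 0ℤ
      vanishes j = mixed-ignores _ (Sum.map (ignores-value (unary C j)) (ignores-value (unary C j)) (avoids-i-or-k j))

    mixed-pairSum : mixed pairSum ≡ mixed (pairAt i k) + mixed (pairAt k i)
    mixed-pairSum = begin
      mixed pairSum                                        ≡⟨ mixed-sumℤ row (allFin n) ⟩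
      sumℤ (map (λ j → mixed (row j)) (allFin n))          ≡⟨ sumℤ-map-pair _ (allFin⁺ n) (∈-allFin i) (∈-allFin k) i≢k
                                                                (λ {j} _ j≢i j≢k → other-row j≢i j≢k) ⟩
      mixed (row i) + mixed (row k)                        ≡⟨ cong₂ _+_ (row-single i (λ l≢k → inj₂ (i≢k , l≢k)))
                                                                        (row-single k (λ l≢i → inj₁ (i≢k ∘ sym , l≢i))) ⟩
      mixed (pairAt i k) + mixed (pairAt k i)              ∎
      where
      open ≡-Reasoning
      row : Fin n → Point n → ℤ
      row j y = sumℤ (map (λ l → pairAt j l y) (allFin n))
      vanishes : ∀ {j l} → (j ≢ i × l ≢ i) ⊎ (j ≢ k × l ≢ k) → mixed (pairAt j l) ≡ 0ℤ
      vanishes {j} {l} (inj₁ (j≢i , l≢i)) = mixed-ignores _ (inj₁ (ignores-pair (pairConstraint j l) j≢i l≢i))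
      vanishes {j} {l} (inj₂ (j≢k , l≢k)) = mixed-ignores _ (inj₂ (ignores-pair (pairConstraint j l) j≢k l≢k))
      row-single : ∀ j {l} → (∀ {l′} → l′ ≢ l → (j ≢ i × l′ ≢ i) ⊎ (j ≢ k × l′ ≢ k)) → mixed (row j) ≡ mixed (pairAt j l)
      row-single j {l} avoids = trans (mixed-sumℤ (pairAt j) (allFin n))
                                      (sumℤ-map-single _ (allFin⁺ n) (∈-allFin l) (λ _ l′≢l → vanishes (avoids l′≢l)))
      other-row : ∀ {j} → j ≢ i → j ≢ k → mixed (row j) ≡ 0ℤ
      other-row {j} j≢i j≢k = trans (mixed-sumℤ (pairAt j) (allFin n)) (sumℤ-map-≡0 _ (allFin n) λ {l} _ → vanishes (avoid l))
        where
        avoid : ∀ l → (j ≢ i × l ≢ i) ⊎ (j ≢ k × l ≢ k)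
        avoid l = Sum.map (j≢i ,_) (j≢k ,_) (avoids-i-or-k l)

    mixed-onPair : ∀ (H : Bool → Bool → ℤ) → let a = x i; b = x k in
                   mixed (λ y → H (y i) (y k)) ≡ (H (not a) (not b) + H a b) - (H (not a) b + H a (not b))
    mixed-onPair H = cong₂ (λ u v → (u + H (x i) (x k)) - v)
                       (cong₂ H (trans (flipAt-other (flipAt x i) i≢k) (flipAt-self x i))
                                (trans (flipAt-self (flipAt x i) k) (cong not (flipAt-other x (i≢k ∘ sym)))))
                       (cong₂ _+_ (cong₂ H (flipAt-self x i) (flipAt-other x (i≢k ∘ sym)))
                                  (cong₂ H (flipAt-other x i≢k) (flipAt-self x k)))

    mixed-fitness : mixed (fitness C) ≡ - interaction i k (x i) (x k)
    mixed-fitness = begin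
      mixed (fitness C)
        ≡⟨ cong₂ _-_ (cong₂ _+_ (decompose y₃) (decompose x)) (cong₂ _+_ (decompose y₁) (decompose y₂)) ⟩
      mixed (λ y → nullary C + unarySum y + pairSum y)
        ≡⟨ split (nullary C) (unarySum y₃) (pairSum y₃) (unarySum x) (pairSum x)
                 (unarySum y₁) (pairSum y₁) (unarySum y₂) (pairSum y₂) ⟩
      mixed unarySum + mixed pairSum
        ≡⟨ cong₂ _+_ mixed-unarySum mixed-pairSum ⟩
      0ℤ + (mixed (pairAt i k) + mixed (pairAt k i))
        ≡⟨ +-identityˡ _ ⟩
      mixed (pairAt i k) + mixed (pairAt k i)
        ≡⟨ cong₂ _+_ (mixed-onPair ik) (mixed-onPair (λ a b → ki b a)) ⟩
      ((ik a′ b′ + ik a b) - (ik a′ b + ik a b′)) + ((ki b′ a′ + ki b a) - (ki b a′ + ki b′ a))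
        ≡⟨ collect (ik a′ b′) (ik a b) (ik a′ b) (ik a b′) (ki b′ a′) (ki b a) (ki b a′) (ki b′ a) ⟩
      - interaction i k a b
        ∎
      where
      open ≡-Reasoning
      decompose = fitness-decomposition
      ik = pairConstraint i k
      ki = pairConstraint k i
      a = x i
      b = x k
      a′ = not a
      b′ = not b
      split : ∀ ν u₃ p₃ u₀ p₀ u₁ p₁ u₂ p₂ →
        (((ν + u₃) + p₃) + ((ν + u₀) + p₀)) - (((ν + u₁) + p₁) + ((ν + u₂) + p₂))
          ≡ ((u₃ + u₀) - (u₁ + u₂)) + ((p₃ + p₀) - (p₁ + p₂))
      split = solve-∀
      collect : ∀ p₁ p₂ p₃ p₄ q₁ q₂ q₃ q₄ →
        ((p₁ + p₂) - (p₃ + p₄)) + ((q₁ + q₂) - (q₃ + q₄)) ≡ - (((p₃ + q₃) + (p₄ + q₄)) - ((p₂ + q₂) + (p₁ + q₁)))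
      collect = solve-∀

  gain-flipAt : ∀ x {i k} → i ≢ k → gain i (flipAt x k) ≡ gain i x - interaction i k (x i) (x k)
  gain-flipAt x {i} {k} i≢k = begin
    fitness C (flipAt y₂ i) - fitness C y₂  ≡⟨ cong (_- fitness C y₂) (fitness-cong (flipAt-comm x i≢k)) ⟩
    fitness C y₃ - fitness C y₂             ≡⟨ telescope (fitness C y₃) (fitness C y₂) (fitness C y₁) (fitness C x) ⟩
    gain i x + mixed (fitness C)            ≡⟨ cong (gain i x +_) mixed-fitness ⟩
    gain i x - interaction i k (x i) (x k)  ∎
    where
    open ≡-Reasoning
    open MixedDifference x i≢k
    telescope : ∀ y₃ y₂ y₁ y₀ → y₃ - y₂ ≡ (y₁ - y₀) + ((y₃ + y₀) - (y₁ + y₂))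
    telescope = solve-∀

  interaction-sym : ∀ i k a b → interaction i k a b ≡ interaction k i b a
  interaction-sym i k a b = swap (pairConstraint i k (not a) b) (pairConstraint k i b (not a))
                                 (pairConstraint i k a (not b)) (pairConstraint k i (not b) a)
                                 (pairConstraint i k a b) (pairConstraint k i b a)
                                 (pairConstraint i k (not a) (not b)) (pairConstraint k i (not b) (not a))
    where
    swap : ∀ p₁ q₁ p₂ q₂ p₃ q₃ p₄ q₄ →
      ((p₁ + q₁) + (p₂ + q₂)) - ((p₃ + q₃) + (p₄ + q₄)) ≡ ((q₂ + p₂) + (q₁ + p₁)) - ((q₃ + p₃) + (q₄ + p₄))
    swap = solve-∀

  interaction-notʳ : ∀ i k a b → interaction i k a (not b) ≡ - interaction i k a b
  interaction-notʳ i k a b rewrite not-involutive b =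
    antisym (edge (not a) (not b)) (edge a b) (edge a (not b)) (edge (not a) b)
    where
    edge = edgeConstraint i k
    antisym : ∀ e₁ e₂ e₃ e₄ → (e₁ + e₂) - (e₃ + e₄) ≡ - ((e₄ + e₃) - (e₂ + e₁))
    antisym = solve-∀

  interaction-notˡ : ∀ i k a b → interaction i k (not a) b ≡ - interaction i k a b
  interaction-notˡ i k a b = begin
    interaction i k (not a) b  ≡⟨ interaction-sym i k (not a) b ⟩
    interaction k i b (not a)  ≡⟨ interaction-notʳ k i b a ⟩
    - interaction k i b a      ≡⟨ cong -_ (interaction-sym k i b a) ⟩
    - interaction i k a b      ∎
    where open ≡-Reasoning

  interaction-vanishes : ∀ i k → (∀ a b → edgeConstraint i k a b ≡ 0ℤ) → ∀ a b → interaction i k a b ≡ 0ℤ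
  interaction-vanishes i k edge≡0 a b rewrite edge≡0 (not a) b | edge≡0 a (not b) | edge≡0 a b | edge≡0 (not a) (not b) = refl

  interaction-self : ∀ i a b → interaction i i a b ≡ 0ℤ
  interaction-self i = interaction-vanishes i i λ a b → cong₂ _+_ (diagonal≡0 a b) (diagonal≡0 b a)
    where
    diagonal≡0 : ∀ a b → pairConstraint i i a b ≡ 0ℤ
    diagonal≡0 a b with i Fin.<? i
    ... | yes i<i = ⊥-elim (Fin.<-irrefl refl i<i)
    ... | no  _   = refl

  nonzero-or-zero : ∀ (g : Bool → Bool → ℤ) → (∃ λ a → ∃ λ b → g a b ≢ 0ℤ) ⊎ (∀ a b → g a b ≡ 0ℤ)
  nonzero-or-zero g with g true true ≟ 0ℤ | g true false ≟ 0ℤ | g false true ≟ 0ℤ | g false false ≟ 0ℤ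
  ... | no  ≢0 | _      | _      | _      = inj₁ (true , true , ≢0)
  ... | yes _  | no ≢0  | _      | _      = inj₁ (true , false , ≢0)
  ... | yes _  | yes _  | no ≢0  | _      = inj₁ (false , true , ≢0)
  ... | yes _  | yes _  | yes _  | no ≢0  = inj₁ (false , false , ≢0)
  ... | yes tt≡0 | yes tf≡0 | yes ft≡0 | yes ff≡0 = inj₂ λ where
    true true → tt≡0 ; true false → tf≡0 ; false true → ft≡0 ; false false → ff≡0

  orderedEdge-or-zero : ∀ u v → OrderedEdge C u v ⊎ (∀ a b → pairConstraint u v a b ≡ 0ℤ)
  orderedEdge-or-zero u v with u Fin.<? v
  ... | no  _   = inj₂ λ _ _ → refl
  ... | yes u<v = Sum.map (u<v ,_) id (nonzero-or-zero (binary C u v))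

  interaction≢0⇒Adj : ∀ i k a b → interaction i k a b ≢ 0ℤ → Adj C i k
  interaction≢0⇒Adj i k a b interaction≢0 with orderedEdge-or-zero i k | orderedEdge-or-zero k i
  ... | inj₁ e    | _         = inj₁ e
  ... | inj₂ _    | inj₁ e    = inj₂ e
  ... | inj₂ ik≡0 | inj₂ ki≡0 = ⊥-elim (interaction≢0 (interaction-vanishes i k (λ a b → cong₂ _+_ (ik≡0 a b) (ki≡0 b a)) a b))

  TurnsFavourable : Fin n → Fin n → Point n → Point n → Set
  TurnsFavourable i k x y = interaction i k (x i) (x k) < 0ℤ × 0ℤ < interaction i k (y i) (y k)

  private
    flip-toward : ∀ {i k x y} → x i ≡ y i → x k ≢ y k → (∀ j → ¬ TurnsFavourable i j x y) →
                  gain i (flipAt x k) ≤ gain i x × (∀ j → ¬ TurnsFavourable i j (flipAt x k) y)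
    flip-toward {i} {k} {x} {y} xi≡yi xk≢yk no-turn = gain-≤ , no-turn′
      where
      i≢k : i ≢ k
      i≢k refl = xk≢yk xi≡yi
      yk≡ : y k ≡ not (x k)
      yk≡ = ¬-not (xk≢yk ∘ sym)
      at-y : interaction i k (y i) (y k) ≡ - interaction i k (x i) (x k)
      at-y = trans (cong₂ (interaction i k) (sym xi≡yi) yk≡) (interaction-notʳ i k (x i) (x k))
      at-flip : interaction i k (flipAt x k i) (flipAt x k k) ≡ interaction i k (y i) (y k)
      at-flip = cong₂ (interaction i k) (trans (flipAt-other x i≢k) xi≡yi) (trans (flipAt-self x k) (sym yk≡))
      nonneg : 0ℤ ≤ interaction i k (x i) (x k)
      nonneg = ≮⇒≥ λ neg → no-turn k (neg , subst (0ℤ <_) (sym at-y) (neg-mono-< neg))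
      gain-≤ : gain i (flipAt x k) ≤ gain i x
      gain-≤ = subst (_≤ gain i x) (sym (gain-flipAt x i≢k))
                 (subst (gain i x - interaction i k (x i) (x k) ≤_) (+-identityʳ (gain i x))
                        (+-monoʳ-≤ (gain i x) (neg-mono-≤ nonneg)))
      no-turn′ : ∀ j → ¬ TurnsFavourable i j (flipAt x k) y
      no-turn′ j = by-cases (j Fin.≟ k)
        where
        by-cases : Dec (j ≡ k) → ¬ TurnsFavourable i j (flipAt x k) y
        by-cases (yes refl) (neg , pos) = <-asym neg (subst (0ℤ <_) (sym at-flip) pos)
        by-cases (no j≢k) (neg , pos) =
          no-turn j (subst₂ (λ u v → interaction i j u v < 0ℤ) (flipAt-other x i≢k) (flipAt-other x j≢k) neg , pos)

  gain-≤ : ∀ {i x y} → x i ≡ y i → (∀ k → ¬ TurnsFavourable i k x y) → gain i y ≤ gain i x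
  gain-≤ {i} {y = y} xi≡yi no-turn = go (allFin n) xi≡yi no-turn (λ j j∉ → ⊥-elim (j∉ (∈-allFin j)))
    where
    go : ∀ L {x} → x i ≡ y i → (∀ k → ¬ TurnsFavourable i k x y) → (∀ j → j ∉ L → x j ≡ y j) → gain i y ≤ gain i x
    go []      {x} _ _ agree = ≤-reflexive (gain-cong i λ j → sym (agree j λ ()))
    go (k ∷ L) {x} xi≡yi no-turn agree with x k Bool.≟ y k
    ... | yes xk≡yk = go L xi≡yi no-turn agree′
      where
      agree′ : ∀ j → j ∉ L → x j ≡ y j
      agree′ j j∉L with j Fin.≟ k
      ... | yes refl = xk≡yk
      ... | no  j≢k  = agree j λ { (here j≡k) → j≢k j≡k ; (there j∈L) → j∉L j∈L }
    ... | no  xk≢yk = ≤-trans (go L (trans (flipAt-other x i≢k) xi≡yi) no-turn′ agree′) gain-decreases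
      where
      i≢k : i ≢ k
      i≢k refl = xk≢yk xi≡yi
      gain-decreases = proj₁ (flip-toward xi≡yi xk≢yk no-turn)
      no-turn′ = proj₂ (flip-toward xi≡yi xk≢yk no-turn)
      agree′ : ∀ j → j ∉ L → flipAt x k j ≡ y j
      agree′ j j∉L = by-cases (j Fin.≟ k)
        where
        by-cases : Dec (j ≡ k) → flipAt x k j ≡ y j
        by-cases (yes refl) = trans (flipAt-self x j) (sym (¬-not (xk≢yk ∘ sym)))
        by-cases (no j≢k)   = trans (flipAt-other x j≢k) (agree j λ { (here j≡k) → j≢k j≡k ; (there j∈L) → j∉L j∈L })

  gain-signChange⇒turnsFavourable : ∀ {i x y} → x i ≡ y i → gain i x < 0ℤ → 0ℤ < gain i y → ∃ λ k → TurnsFavourable i k x y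
  gain-signChange⇒turnsFavourable {i} {x} {y} xi≡yi neg pos with Fin.any? (λ k → (_ <? 0ℤ) ×-dec (0ℤ <? _))
  ... | yes turn   = turn
  ... | no  ¬turn = ⊥-elim (<-irrefl refl (<-≤-trans (ℤ.<-trans neg pos) (gain-≤ xi≡yi λ k t → ¬turn (k , t))))

module Lists {A : Set} where

  open import Data.List.Properties using (unfold-reverse; ++-assoc)
  open import Data.List.Relation.Unary.All.Properties using (++⁻ˡ)
  import Data.List.Relation.Unary.Any.Properties as Any
  open import Data.List.Relation.Unary.Unique.Propositional.Properties using (++⁺)

  Unique-++⁻ˡ : ∀ xs {ys : List A} → Unique (xs ++ ys) → Unique xs
  Unique-++⁻ˡ []       _          = []
  Unique-++⁻ˡ (x ∷ xs) (x∉ ∷ uniq) = ++⁻ˡ xs x∉ ∷ Unique-++⁻ˡ xs uniq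

  Unique-++-disjoint : ∀ xs {ys : List A} {y} → Unique (xs ++ ys) → y ∈ xs → y ∉ ys
  Unique-++-disjoint (x ∷ xs) (x∉ ∷ _)    (here refl) y∈ys = All.lookup x∉ (∈-++⁺ʳ xs y∈ys) refl
  Unique-++-disjoint (x ∷ xs) (_  ∷ uniq) (there y∈xs) y∈ys = Unique-++-disjoint xs uniq y∈xs y∈ys

  Unique-reverse : ∀ {xs : List A} → Unique xs → Unique (reverse xs)
  Unique-reverse {[]}     [] = []
  Unique-reverse {x ∷ xs} (x∉ ∷ uniq) = subst Unique (sym (unfold-reverse x xs))
    (++⁺ (Unique-reverse uniq) ([] ∷ []) λ { (x∈ , here refl) → All.lookup x∉ (Any.reverse⁻ x∈) refl })

  module _ {R : A → A → Set} where

    Linked-prefix : ∀ xs {z ys} → Linked R (xs ++ z ∷ ys) → Linked R (xs ++ [ z ])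
    Linked-prefix []            _         = [-]
    Linked-prefix (x ∷ [])      (r ∷ _)   = r ∷ [-]
    Linked-prefix (x ∷ x′ ∷ xs) (r ∷ lnk) = r ∷ Linked-prefix (x′ ∷ xs) lnk

    Linked-glue : ∀ xs {z ys} → Linked R (xs ++ [ z ]) → Linked R (z ∷ ys) → Linked R (xs ++ z ∷ ys)
    Linked-glue []            _             lnk = lnk
    Linked-glue (x ∷ [])      (r ∷ [-])     lnk = r ∷ lnk
    Linked-glue (x ∷ x′ ∷ xs) (r ∷ prefix) lnk = r ∷ Linked-glue (x′ ∷ xs) prefix lnk

    Linked-reverse : (∀ {u v} → R u v → R v u) → ∀ {xs} → Linked R xs → Linked R (reverse xs)
    Linked-reverse R-sym []  = []
    Linked-reverse R-sym [-] = [-]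
    Linked-reverse R-sym {x ∷ y ∷ xs} (r ∷ lnk) = subst (Linked R) (sym reverse≡)
      (Linked-glue (reverse xs) (subst (Linked R) (unfold-reverse y xs) (Linked-reverse R-sym lnk)) (R-sym r ∷ [-]))
      where
      reverse≡ : reverse (x ∷ y ∷ xs) ≡ reverse xs ++ y ∷ [ x ]
      reverse≡ = trans (unfold-reverse x (y ∷ xs))
                       (trans (cong (_++ [ x ]) (unfold-reverse y xs)) (++-assoc (reverse xs) [ y ] [ x ]))

module Forests {A : Set} (_≟_ : DecidableEquality A) (R : A → A → Set)
               (R-sym : ∀ {u v} → R u v → R v u) (R-irrefl : ∀ {u} → ¬ R u u)
               (acyclic : ∀ v vs → ¬ (Unique (v ∷ vs) × 2 ℕ.≤ length vs × Linked R (v ∷ vs ++ [ v ]))) where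

  open Lists
  open import Data.List.Membership.DecPropositional _≟_ using (_∈?_)
  open import Data.List.Properties using (reverse-++; unfold-reverse; ++-assoc; length-reverse)
  import Data.List.Relation.Unary.Any.Properties as Any
  open import Data.List.Relation.Unary.Unique.Propositional.Properties using (++⁺)

  NonBacktracking : List A → Set
  NonBacktracking (u ∷ v ∷ w ∷ rest) = u ≢ w × NonBacktracking (v ∷ w ∷ rest)
  NonBacktracking _                  = ⊤

  private
    NonBacktracking-tail : ∀ {v} rest → NonBacktracking (v ∷ rest) → NonBacktracking rest
    NonBacktracking-tail []            _        = tt
    NonBacktracking-tail (_ ∷ [])      _        = tt
    NonBacktracking-tail (_ ∷ _ ∷ _)   (_ , nb) = nb

    not-revisited : ∀ {v rest} → Unique rest → Linked R (v ∷ rest) → NonBacktracking (v ∷ rest) → v ∉ rest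
    not-revisited {v} uniq lnk nb v∈rest with ∈-∃++ v∈rest
    ... | loop , _ , refl = acyclic v loop (Unique-loop , long-loop loop lnk nb , Linked-prefix (v ∷ loop) lnk)
      where
      Unique-loop : Unique (v ∷ loop)
      Unique-loop = All.tabulate (λ y∈loop v≡y → Unique-++-disjoint loop uniq y∈loop (here (sym v≡y))) ∷ Unique-++⁻ˡ loop uniq
      long-loop : ∀ loop {rest} → Linked R (v ∷ loop ++ v ∷ rest) → NonBacktracking (v ∷ loop ++ v ∷ rest) → 2 ℕ.≤ length loop
      long-loop []            (r ∷ _) _        = ⊥-elim (R-irrefl r)
      long-loop (_ ∷ [])      _       (v≢v , _) = ⊥-elim (v≢v refl)
      long-loop (_ ∷ _ ∷ _)   _       _        = ℕ.s≤s (ℕ.s≤s ℕ.z≤n)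

  nonBacktracking⇒Unique : ∀ {walk} → Linked R walk → NonBacktracking walk → Unique walk
  nonBacktracking⇒Unique {[]}        _   _  = []
  nonBacktracking⇒Unique {v ∷ rest} lnk nb = ¬Any⇒All¬ rest (not-revisited uniq lnk nb) ∷ uniq
    where
    uniq : Unique rest
    uniq = nonBacktracking⇒Unique (Linked.tail lnk) (NonBacktracking-tail rest nb)

  IsPath : List A → Set
  IsPath vs = Linked R vs × Unique vs

  record FirstCommon (M M′ : List A) : Set where
    field
      before after : List A
      vertex       : A
      split        : M ≡ before ++ vertex ∷ after
      vertex∈      : vertex ∈ M′
      before∉      : ∀ {y} → y ∈ before → y ∉ M′

  firstCommon : ∀ M M′ {z} → z ∈ M → z ∈ M′ → FirstCommon M M′
  firstCommon (y ∷ M) M′ z∈M z∈M′ with y ∈? M′ | z∈M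
  ... | yes y∈M′ | _          = record { before = [] ; split = refl ; vertex∈ = y∈M′ ; before∉ = λ () }
  ... | no  y∉M′ | here refl  = ⊥-elim (y∉M′ z∈M′)
  ... | no  y∉M′ | there z∈M₁ = record
    { before = y ∷ before ; split = cong (y ∷_) split ; vertex∈ = vertex∈
    ; before∉ = λ { (here refl) → y∉M′ ; (there y∈) → before∉ y∈ } }
    where open FirstCommon (firstCommon M M′ z∈M₁ z∈M′)

  private
    cycle-long : ∀ {x x′ w : A} {B B′ after after′} before before′ → x ∷ B ≡ before ++ w ∷ after →
                 x′ ∷ B′ ≡ before′ ++ w ∷ after′ → x ≢ x′ → 2 ℕ.≤ length (before ++ w ∷ reverse before′)
    cycle-long (_ ∷ [])    _             _    _    _   = ℕ.s≤s (ℕ.s≤s ℕ.z≤n)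
    cycle-long (_ ∷ _ ∷ _) _             _    _    _   = ℕ.s≤s (ℕ.s≤s ℕ.z≤n)
    cycle-long []          []            refl refl x≢x = ⊥-elim (x≢x refl)
    cycle-long []          (y ∷ before′) _    _    _   =
      ℕ.s≤s (subst (1 ℕ.≤_) (sym (length-reverse (y ∷ before′))) (ℕ.s≤s ℕ.z≤n))

  -- The two branches first meet at some w; walking out along one branch and back along the other closes a cycle.
  branches-disjoint : ∀ {a x x′ B B′ z} → IsPath (a ∷ x ∷ B) → IsPath (a ∷ x′ ∷ B′) → x ≢ x′ → z ∈ x ∷ B → z ∉ x′ ∷ B′
  branches-disjoint {a} {x} {x′} {B} {B′} (lnk , a∉ ∷ uniq) (lnk′ , a∉′ ∷ uniq′) x≢x′ z∈ z∈′
    with firstCommon (x ∷ B) (x′ ∷ B′) z∈ z∈′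
  ... | record { before = before ; vertex = w ; split = split ; vertex∈ = w∈′ ; before∉ = before∉ }
    with ∈-∃++ w∈′
  ... | before′ , after′ , split′ = acyclic a cycle (Unique-cycle , cycle-long before before′ split split′ x≢x′ , Linked-cycle)
    where
    cycle : List A
    cycle = before ++ w ∷ reverse before′
    uniq-w : Unique (before ++ w ∷ _)
    uniq-w = subst Unique split uniq
    uniq-w′ : Unique (before′ ++ w ∷ after′)
    uniq-w′ = subst Unique split′ uniq′
    ∈-reversed : ∀ {y} → y ∈ reverse before′ → y ∈ before′
    ∈-reversed = Any.reverse⁻
    ∈-branches : ∀ {y} → y ∈ cycle → y ∈ x ∷ B ⊎ y ∈ x′ ∷ B′
    ∈-branches y∈ with ∈-++⁻ before y∈
    ... | inj₁ y∈before         = inj₁ (subst (_ ∈_) (sym split) (∈-++⁺ˡ y∈before))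
    ... | inj₂ (here refl)      = inj₂ w∈′
    ... | inj₂ (there y∈before′) = inj₂ (subst (_ ∈_) (sym split′) (∈-++⁺ˡ (∈-reversed y∈before′)))
    Unique-return : Unique (w ∷ reverse before′)
    Unique-return = All.tabulate (λ y∈ w≡y → Unique-++-disjoint before′ uniq-w′ (∈-reversed y∈) (here (sym w≡y)))
                  ∷ Unique-reverse (Unique-++⁻ˡ before′ uniq-w′)
    Unique-cycle : Unique (a ∷ cycle)
    Unique-cycle = All.tabulate (λ y∈ a≡y → [ All.lookup a∉ , All.lookup a∉′ ]′ (∈-branches y∈) a≡y)
                 ∷ ++⁺ (Unique-++⁻ˡ before uniq-w) Unique-return
                       (λ { (y∈ , here refl) → before∉ y∈ w∈′
                          ; (y∈ , there y∈′) → before∉ y∈ (subst (_ ∈_) (sym split′) (∈-++⁺ˡ (∈-reversed y∈′))) })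
    Linked-cycle : Linked R (a ∷ cycle ++ [ a ])
    Linked-cycle = subst (λ l → Linked R (a ∷ l)) (sym (++-assoc before (w ∷ reverse before′) [ a ]))
      (Linked-glue (a ∷ before) (Linked-prefix (a ∷ before) (subst (λ l → Linked R (a ∷ l)) split lnk))
        (subst (Linked R) (trans (reverse-++ (a ∷ before′) [ w ]) (cong (w ∷_) (unfold-reverse a before′)))
          (Linked-reverse R-sym (Linked-prefix (a ∷ before′) (subst (λ l → Linked R (a ∷ l)) split′ lnk′)))))

module UnorderedPairs where

  open import Data.Nat using (zero; suc; _+_; _≤_; _<_)
  open import Data.Nat.Properties
  open import Data.Nat.Combinatorics using (_C_; nC1≡n; nCk+nC[k+1]≡[n+1]C[k+1])
  open import Relation.Binary.Definitions using (tri<; tri≈; tri>)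

  SamePair : ∀ {B : Set} → B → B → B → B → Set
  SamePair a b a′ b′ = (a ≡ a′ × b ≡ b′) ⊎ (a ≡ b′ × b ≡ a′)

  triangle : ℕ → ℕ
  triangle zero    = 0
  triangle (suc k) = triangle k + suc k

  triangle≡ : ∀ n → triangle n ≡ n C 2 + n
  triangle≡ zero    = refl
  triangle≡ (suc n) = begin
    triangle n + suc n         ≡⟨ cong (_+ suc n) (triangle≡ n) ⟩
    (n C 2 + n) + suc n        ≡⟨ cong (_+ suc n) (+-comm (n C 2) n) ⟩
    (n + n C 2) + suc n        ≡⟨ cong (λ k → (k + n C 2) + suc n) (nC1≡n n) ⟨
    (n C 1 + n C 2) + suc n    ≡⟨ cong (_+ suc n) (nCk+nC[k+1]≡[n+1]C[k+1] n 1) ⟩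
    suc n C 2 + suc n          ∎
    where open ≡-Reasoning

  triangle-mono : ∀ {a b} → a ≤ b → triangle a ≤ triangle b
  triangle-mono {a} {b} a≤b with m≤n⇒m<n∨m≡n a≤b
  ... | inj₂ refl = ≤-refl
  triangle-mono {a} {suc b} _ | inj₁ a<1+b = ≤-trans (triangle-mono (≤-pred a<1+b)) (m≤m+n (triangle b) (suc b))

  -- The pair {α ≤ β} is coded as triangle β + α; the codes with larger entry β lie in [triangle β, triangle (suc β)).
  private
    code-< : ∀ {α β α′ β′} → α ≤ β → β < β′ → triangle β + α < triangle β′ + α′
    code-< {α} {β} {α′} {β′} α≤β β<β′ =
      ≤-<-trans (+-monoʳ-≤ (triangle β) α≤β)
        (<-≤-trans (+-monoʳ-< (triangle β) (n<1+n β)) (≤-trans (triangle-mono β<β′) (m≤m+n (triangle β′) α′)))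

    code-injective : ∀ {α β α′ β′} → α ≤ β → α′ ≤ β′ → triangle β + α ≡ triangle β′ + α′ → α ≡ α′ × β ≡ β′
    code-injective {α} {β} {α′} {β′} α≤β α′≤β′ code≡ with <-cmp β β′
    ... | tri< β<β′ _ _    = ⊥-elim (<-irrefl code≡ (code-< α≤β β<β′))
    ... | tri> _ _ β′<β    = ⊥-elim (<-irrefl (sym code≡) (code-< α′≤β′ β′<β))
    ... | tri≈ _ refl _    = +-cancelˡ-≡ (triangle β) α α′ code≡ , refl

  pairCode : ℕ → ℕ → ℕ
  pairCode α β with α ≤? β
  ... | yes _ = triangle β + α
  ... | no  _ = triangle α + β

  pairCode-< : ∀ {α β n} → α < n → β < n → pairCode α β < triangle n
  pairCode-< {α} {β} α<n β<n with α ≤? β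
  ... | yes α≤β = <-≤-trans (subst (triangle β + α <_) (+-identityʳ _) (code-< α≤β (n<1+n β))) (triangle-mono β<n)
  ... | no  α≰β = <-≤-trans (subst (triangle α + β <_) (+-identityʳ _) (code-< (<⇒≤ (≰⇒> α≰β)) (n<1+n α))) (triangle-mono α<n)

  pairCode-injective : ∀ α β α′ β′ → pairCode α β ≡ pairCode α′ β′ → SamePair α β α′ β′
  pairCode-injective α β α′ β′ code≡ with α ≤? β | α′ ≤? β′
  ... | yes α≤β | yes α′≤β′ = inj₁ (code-injective α≤β α′≤β′ code≡)
  ... | yes α≤β | no  α′≰β′ = inj₂ (code-injective α≤β (<⇒≤ (≰⇒> α′≰β′)) code≡)
  ... | no  α≰β | yes α′≤β′ = inj₂ (Product.swap (code-injective (<⇒≤ (≰⇒> α≰β)) α′≤β′ code≡))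
  ... | no  α≰β | no  α′≰β′ = inj₁ (Product.swap (code-injective (<⇒≤ (≰⇒> α≰β)) (<⇒≤ (≰⇒> α′≰β′)) code≡))

  unorderedPair-injection⇒≤ : ∀ {m n} (k₁ k₂ : Fin m → Fin n) →
    (∀ s t → SamePair (k₁ s) (k₂ s) (k₁ t) (k₂ t) → s ≡ t) → m ≤ n C 2 + n
  unorderedPair-injection⇒≤ {m} {n} k₁ k₂ injective = subst (m ≤_) (triangle≡ n) (≮⇒≥ too-many)
    where
    code : Fin m → Fin (triangle n)
    code t = fromℕ< (pairCode-< (Fin.toℕ<n (k₁ t)) (Fin.toℕ<n (k₂ t)))
    too-many : ¬ (triangle n < m)
    too-many triangle<m with Fin.pigeonhole triangle<m code
    ... | s , t , s<t , code≡ = <-irrefl (cong toℕ (injective s t (Sum.map (map-toℕ-injective) map-toℕ-injective same))) s<t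
      where
      same : SamePair (toℕ (k₁ s)) (toℕ (k₂ s)) (toℕ (k₁ t)) (toℕ (k₂ t))
      same = pairCode-injective _ _ _ _ (trans (sym (Fin.toℕ-fromℕ< _)) (trans (cong toℕ code≡) (Fin.toℕ-fromℕ< _)))
      map-toℕ-injective : ∀ {a b c d : Fin n} → toℕ a ≡ toℕ c × toℕ b ≡ toℕ d → a ≡ c × b ≡ d
      map-toℕ-injective (a≡ , b≡) = Fin.toℕ-injective a≡ , Fin.toℕ-injective b≡

module Search where

  open import Data.Nat using (zero; suc; _≤_; _<_; _≤?_; s≤s⁻¹)
  open import Data.Nat.Properties using (≤-refl; ≤-trans; <⇒≤; <-irrefl; <-≤-trans; m<1+n⇒m<n∨m≡n; m≤n⇒m≤1+n)
  open import Relation.Unary using (Decidable)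

  data LastIn (P : ℕ → Set) (a b : ℕ) : Set where
    none : (∀ {r} → a ≤ r → r < b → ¬ P r) → LastIn P a b
    last : ∀ r → a ≤ r → r < b → P r → (∀ {r′} → r < r′ → r′ < b → ¬ P r′) → LastIn P a b

  private
    extend : ∀ {P a b} → ¬ (a ≤ b × P b) → LastIn P a b → LastIn P a (suc b)
    extend {P} {a} {b} b-fails (none ¬P) = none λ a≤r r<1+b → below-or-b a≤r (m<1+n⇒m<n∨m≡n r<1+b)
      where
      below-or-b : ∀ {r} → a ≤ r → r < b ⊎ r ≡ b → ¬ P r
      below-or-b a≤r (inj₁ r<b)  = ¬P a≤r r<b
      below-or-b a≤r (inj₂ refl) = b-fails ∘ (a≤r ,_)
    extend {P} {a} {b} b-fails (last r a≤r r<b Pr ¬P) =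
      last r a≤r (m≤n⇒m≤1+n r<b) Pr λ r<r′ r′<1+b → after-r r<r′ (m<1+n⇒m<n∨m≡n r′<1+b)
      where
      after-r : ∀ {r′} → r < r′ → r′ < b ⊎ r′ ≡ b → ¬ P r′
      after-r r<r′ (inj₁ r′<b)  = ¬P r<r′ r′<b
      after-r r<r′ (inj₂ refl) = b-fails ∘ (≤-trans a≤r (<⇒≤ r<r′) ,_)

  lastIn : ∀ {P} → Decidable P → ∀ a b → LastIn P a b
  lastIn P? a zero = none λ _ ()
  lastIn P? a (suc b) with a ≤? b | P? b
  ... | yes a≤b | yes Pb = last b a≤b ≤-refl Pb λ b<r′ r′<1+b _ → <-irrefl refl (<-≤-trans b<r′ (s≤s⁻¹ r′<1+b))
  ... | yes _   | no ¬Pb = extend (¬Pb ∘ proj₂) (lastIn P? a b)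
  ... | no  a≰b | _      = extend (a≰b ∘ proj₁) (lastIn P? a b)

module Runs where

  open import Data.Integer as ℤ using (ℤ; 0ℤ; _-_; -_)
  import Data.Integer.Properties as ℤ
  open import Data.Nat using (zero; suc; _+_; _≤_; _<_; z≤n; s≤s; s≤s⁻¹)
  open import Data.Nat.Properties
  open import Data.Nat.Combinatorics using (_C_)
  open import Data.Nat.Induction using (<-rec)
  open import Relation.Binary.Definitions using (tri<; tri≈; tri>)
  open import Data.List.Properties using (reverse-++)
  import Data.List.Relation.Unary.Any.Properties as Any
  open Flips
  open Search

  record Run {n} (𝒞 : VCSP n) (m : ℕ) : Set where
    field
      point     : ℕ → Point n
      flipped   : ℕ → Fin n
      point-suc : ∀ {t} → t < m → point (suc t) ≗ flipAt (point t) (flipped t)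
      improves  : ∀ {t} → t < m → fitness 𝒞 (point t) ℤ.< fitness 𝒞 (point (suc t))

  Adj-sym : ∀ {n} {𝒞 : VCSP n} {u v} → Adj 𝒞 u v → Adj 𝒞 v u
  Adj-sym (inj₁ e) = inj₂ e
  Adj-sym (inj₂ e) = inj₁ e

  Adj-irrefl : ∀ {n} {𝒞 : VCSP n} {u} → ¬ Adj 𝒞 u u
  Adj-irrefl (inj₁ (u<u , _)) = Fin.<-irrefl refl u<u
  Adj-irrefl (inj₂ (u<u , _)) = Fin.<-irrefl refl u<u

  module RunAnalysis {n} {𝒞 : VCSP n} (acyclic : Acyclic 𝒞) {m} (run : Run 𝒞 m) where

    open Run run
    open Interaction 𝒞
    open Lists
    open Forests Fin._≟_ (Adj 𝒞) (Adj-sym {𝒞 = 𝒞}) (Adj-irrefl {𝒞 = 𝒞}) acyclic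

    Unflipped : Fin n → ℕ → ℕ → Set
    Unflipped v a b = ∀ {r} → a ≤ r → r < b → flipped r ≢ v

    Unflipped-shrink : ∀ {v a a′ b} → a ≤ a′ → Unflipped v a b → Unflipped v a′ b
    Unflipped-shrink a≤a′ unflipped a′≤r = unflipped (≤-trans a≤a′ a′≤r)

    Unflipped⇒stable : ∀ {v a} b → Unflipped v a b → a ≤ b → b ≤ m → point b v ≡ point a v
    Unflipped⇒stable {v} {a} b unflipped a≤b b≤m with m≤n⇒m<n∨m≡n a≤b
    ... | inj₂ refl = refl
    Unflipped⇒stable {v} {a} (suc b) unflipped _ b<m | inj₁ a<1+b = begin
      point (suc b) v             ≡⟨ point-suc b<m v ⟩
      flipAt (point b) (flipped b) v ≡⟨ flipAt-other (point b) (unflipped (s≤s⁻¹ a<1+b) ≤-refl ∘ sym) ⟩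
      point b v                   ≡⟨ Unflipped⇒stable b (λ a≤r r<b → unflipped a≤r (m≤n⇒m≤1+n r<b)) (s≤s⁻¹ a<1+b) (<⇒≤ b<m) ⟩
      point a v                   ∎
      where open ≡-Reasoning

    interactionAt : Fin n → Fin n → ℕ → ℤ
    interactionAt u v t = interaction u v (point t u) (point t v)

    interactionAt-sym : ∀ u v t → interactionAt u v t ≡ interactionAt v u t
    interactionAt-sym u v t = interaction-sym u v (point t u) (point t v)

    interactionAt-stable : ∀ {u v a b} → Unflipped u a b → Unflipped v a b → a ≤ b → b ≤ m →
                           interactionAt u v b ≡ interactionAt u v a
    interactionAt-stable {u} {v} {b = b} unflipped-u unflipped-v a≤b b≤m =
      cong₂ (interaction u v) (Unflipped⇒stable b unflipped-u a≤b b≤m) (Unflipped⇒stable b unflipped-v a≤b b≤m)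

    interactionAt-flipˡ : ∀ {u v t} → t < m → flipped t ≡ u → v ≢ u → interactionAt u v (suc t) ≡ - interactionAt u v t
    interactionAt-flipˡ {u} {v} {t} t<m refl v≢u = trans
      (cong₂ (interaction u v) (trans (point-suc t<m u) (flipAt-self (point t) u))
                               (trans (point-suc t<m v) (flipAt-other (point t) v≢u)))
      (interaction-notˡ u v (point t u) (point t v))

    interactionAt-flipʳ : ∀ {u v t} → t < m → flipped t ≡ v → u ≢ v → interactionAt u v (suc t) ≡ - interactionAt u v t
    interactionAt-flipʳ {u} {v} {t} t<m flipped≡v u≢v = begin
      interactionAt u v (suc t) ≡⟨ interactionAt-sym u v (suc t) ⟩
      interactionAt v u (suc t) ≡⟨ interactionAt-flipˡ t<m flipped≡v u≢v ⟩
      - interactionAt v u t     ≡⟨ cong -_ (interactionAt-sym u v t) ⟨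
      - interactionAt u v t     ∎
      where open ≡-Reasoning

    gain-before : ∀ {t} → t < m → 0ℤ ℤ.< gain (flipped t) (point t)
    gain-before {t} t<m = subst (λ f → 0ℤ ℤ.< f - fitness 𝒞 (point t)) (fitness-cong (point-suc t<m)) (0<b-a (improves t<m))
      where
      0<b-a : ∀ {a b} → a ℤ.< b → 0ℤ ℤ.< b - a
      0<b-a {a} {b} a<b = subst (ℤ._< b - a) (ℤ.+-inverseʳ a) (ℤ.+-monoˡ-< (- a) a<b)

    gain-after : ∀ {t} → t < m → gain (flipped t) (point (suc t)) ℤ.< 0ℤ
    gain-after {t} t<m =
      subst (λ f → f - fitness 𝒞 (point (suc t)) ℤ.< 0ℤ) (fitness-cong (sym ∘ flipped-back)) (a-b<0 (improves t<m))
      where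
      flipped-back : flipAt (point (suc t)) (flipped t) ≗ point t
      flipped-back j = trans (flipAt-cong (flipped t) (point-suc t<m) j) (flipAt-involutive (point t) (flipped t) j)
      a-b<0 : ∀ {a b} → a ℤ.< b → a - b ℤ.< 0ℤ
      a-b<0 {a} {b} a<b = subst (a - b ℤ.<_) (ℤ.+-inverseʳ b) (ℤ.+-monoˡ-< (- b) a<b)

    IsFirstFlip : ℕ → Set
    IsFirstFlip t = t < m × (∀ {s} → s < t → flipped s ≢ flipped t)

    -- Flip t of u = flipped t is blamed on flip r when r is the last flip, since the previous flip of u,
    -- of a neighbour of u whose interaction with u has turned favourable.
    record Blame (t r : ℕ) : Set where
      field
        t<m         : t < m
        r<t         : r < t
        not-first   : ¬ IsFirstFlip t
        distinct    : flipped r ≢ flipped t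
        t-unflipped : Unflipped (flipped t) r t
        r-unflipped : Unflipped (flipped r) (suc r) t
        favourable  : 0ℤ ℤ.< interactionAt (flipped t) (flipped r) t

    previous-or-first : ∀ {t} → t < m →
      IsFirstFlip t ⊎ ∃ λ s → s < t × flipped s ≡ flipped t × Unflipped (flipped t) (suc s) t
    previous-or-first {t} t<m with lastIn (λ s → flipped s Fin.≟ flipped t) 0 t
    ... | none never                  = inj₁ (t<m , never z≤n)
    ... | last s _ s<t same unflipped = inj₂ (s , s<t , same , unflipped)

    blame-exists : ∀ {t s} → t < m → s < t → flipped s ≡ flipped t → Unflipped (flipped t) (suc s) t → ∃ (Blame t)
    blame-exists {t} {s} t<m s<t same unflipped
      with gain-signChange⇒turnsFavourable {x = point (suc s)} {y = point t}
             (sym (Unflipped⇒stable t unflipped s<t (<⇒≤ t<m)))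
             (subst (λ v → gain v (point (suc s)) ℤ.< 0ℤ) same (gain-after (<-trans s<t t<m)))
             (gain-before t<m)
    ... | k , unfavourable , favourable with lastIn (λ r → flipped r Fin.≟ k) (suc s) t
    ...   | none k-unflipped = ⊥-elim (ℤ.<-asym unfavourable
                                  (subst (0ℤ ℤ.<_) (interactionAt-stable unflipped k-unflipped s<t (<⇒≤ t<m)) favourable))
    ...   | last r s<r r<t flipped≡k k-unflipped = r , record
      { t<m         = t<m
      ; r<t         = r<t
      ; not-first   = λ (_ , first) → first s<t same
      ; distinct    = λ r≡t → k≢u (trans (sym flipped≡k) r≡t)
      ; t-unflipped = Unflipped-shrink s<r unflipped
      ; r-unflipped = λ r<r′ r′<t flipped≡ → k-unflipped r<r′ r′<t (trans flipped≡ flipped≡k)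
      ; favourable  = subst (λ v → 0ℤ ℤ.< interactionAt (flipped t) v t) (sym flipped≡k) favourable
      }
      where
      k≢u : k ≢ flipped t
      k≢u refl = ℤ.<-irrefl refl (subst (ℤ._< 0ℤ) (interaction-self k _ _) unfavourable)

    infixr 5 _◂_
    infixl 5 _▸_
    data Chain : ℕ → ℕ → List (Fin n) → Set where
      stop  : ∀ {a} → Chain a a [ flipped a ]
      _◂_  : ∀ {a r b K} → Blame a r → Chain r b K → Chain a b (flipped a ∷ K)

    record Origin (t : ℕ) : Set where
      field
        first   : ℕ
        walk    : List (Fin n)
        chain   : Chain t first walk
        isFirst : IsFirstFlip first

    origin : ∀ {t} → t < m → Origin t
    origin {t} = <-rec (λ t → t < m → Origin t) step t
      where
      step : ∀ t → (∀ {r} → r < t → r < m → Origin r) → t < m → Origin t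
      step t earlier t<m with previous-or-first t<m
      ... | inj₁ isFirst = record { chain = stop ; isFirst = isFirst }
      ... | inj₂ (s , s<t , same , unflipped) with blame-exists t<m s<t same unflipped
      ...   | r , blame = record { chain = blame ◂ chain ; isFirst = isFirst }
        where open Origin (earlier (Blame.r<t blame) (<-trans (Blame.r<t blame) t<m))

    Blame⇒Adj : ∀ {t r} → Blame t r → Adj 𝒞 (flipped t) (flipped r)
    Blame⇒Adj blame = interaction≢0⇒Adj _ _ _ _ λ ≡0 → ℤ.<-irrefl refl (subst (0ℤ ℤ.<_) ≡0 (Blame.favourable blame))

    -- If flip r were blamed on a flip of u = flipped t, then flip r would have made the interaction of
    -- u with flipped r unfavourable, and neither variable flips again before t.
    blames-not-reversed : ∀ {t r r′} → Blame t r → Blame r r′ → flipped r′ ≢ flipped t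
    blames-not-reversed {t} {r} {r′} blame blame′ r′≡t = ℤ.<-asym (Blame.favourable blame) unfavourable
      where
      u = flipped t
      v = flipped r
      favourable-at-r : 0ℤ ℤ.< interactionAt u v r
      favourable-at-r = subst (0ℤ ℤ.<_) (interactionAt-sym v u r)
                          (subst (λ w → 0ℤ ℤ.< interactionAt v w r) r′≡t (Blame.favourable blame′))
      unfavourable : interactionAt u v t ℤ.< 0ℤ
      unfavourable = subst (ℤ._< 0ℤ)
        (sym (trans (interactionAt-stable (Unflipped-shrink (n≤1+n r) (Blame.t-unflipped blame)) (Blame.r-unflipped blame)
                                         (Blame.r<t blame) (<⇒≤ (Blame.t<m blame)))
                    (interactionAt-flipʳ (<-trans (Blame.r<t blame) (Blame.t<m blame)) refl (Blame.distinct blame ∘ sym))))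
        (ℤ.neg-mono-< favourable-at-r)

    Chain-walk : ∀ {a b K} → Chain a b K → Linked (Adj 𝒞) K × NonBacktracking K
    Chain-walk stop                     = [-] , tt
    Chain-walk (blame ◂ stop)           = Blame⇒Adj blame ∷ [-] , tt
    Chain-walk (blame ◂ blame′ ◂ stop)  = Blame⇒Adj blame ∷ Blame⇒Adj blame′ ∷ [-] , blames-not-reversed blame blame′ ∘ sym , tt
    Chain-walk (blame ◂ blame′ ◂ chain@(_ ◂ _)) with Chain-walk (blame′ ◂ chain)
    ... | walk , nonBacktracking = Blame⇒Adj blame ∷ walk , blames-not-reversed blame blame′ ∘ sym , nonBacktracking

    Chain-Unique : ∀ {a b K} → Chain a b K → Unique K
    Chain-Unique chain = nonBacktracking⇒Unique (proj₁ (Chain-walk chain)) (proj₂ (Chain-walk chain))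

    Chain-end : ∀ {a b K} → Chain a b K → flipped b ∈ K
    Chain-end stop          = here refl
    Chain-end (_ ◂ chain)   = there (Chain-end chain)

    Chain-head : ∀ {a b K} → Chain a b K → ∃ λ K′ → K ≡ flipped a ∷ K′
    Chain-head stop    = [] , refl
    Chain-head (_ ◂ _) = _ , refl

    Chain-last : ∀ {a b K} → Chain a b K → ∃ λ K′ → K ≡ K′ ++ [ flipped b ]
    Chain-last stop = [] , refl
    Chain-last {a} (_ ◂ chain) with Chain-last chain
    ... | K′ , refl = flipped a ∷ K′ , refl

    Chain-unsnoc : ∀ {a b K} → Chain a b K → a ≡ b ⊎ (∃ λ s → ∃ λ K′ → Chain a s K′ × Blame s b)
    Chain-unsnoc stop = inj₁ refl
    Chain-unsnoc {a} (blame ◂ chain) with Chain-unsnoc chain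
    ... | inj₁ refl                      = inj₂ (a , _ , stop , blame)
    ... | inj₂ (s , _ , chain′ , blame′) = inj₂ (s , _ , blame ◂ chain′ , blame′)

    Chain-never-returns : ∀ {a r b K} → Blame a r → Chain r b K → flipped a ≢ flipped b
    Chain-never-returns blame chain with Chain-Unique (blame ◂ chain)
    ... | a∉K ∷ _ = All.lookup a∉K (Chain-end chain)

    firstFlip-unique : ∀ {f f′} → IsFirstFlip f → IsFirstFlip f′ → flipped f ≡ flipped f′ → f ≡ f′
    firstFlip-unique {f} {f′} (_ , first) (_ , first′) same with <-cmp f f′
    ... | tri< f<f′ _ _ = ⊥-elim (first′ f<f′ same)
    ... | tri≈ _ f≡f′ _ = f≡f′
    ... | tri> _ _ f′<f = ⊥-elim (first f′<f (sym same))

    firstFlip-≤ : ∀ {f t} → IsFirstFlip f → flipped t ≡ flipped f → f ≤ t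
    firstFlip-≤ (_ , first) same = ≮⇒≥ λ t<f → first t<f same

    blame-injective : ∀ {t t′ r} → Blame t r → Blame t′ r → flipped t ≡ flipped t′ → t ≡ t′
    blame-injective {t} {t′} blame blame′ same with <-cmp t t′
    ... | tri< t<t′ _ _ = ⊥-elim (Blame.t-unflipped blame′ (<⇒≤ (Blame.r<t blame)) t<t′ same)
    ... | tri≈ _ t≡t′ _ = t≡t′
    ... | tri> _ _ t′<t = ⊥-elim (Blame.t-unflipped blame (<⇒≤ (Blame.r<t blame′)) t′<t (sym same))

    branch : ∀ {a r b K} → Blame a r → Chain r b K → ∃ λ A → K ≡ flipped r ∷ A × IsPath (flipped a ∷ flipped r ∷ A)
    branch blame chain with Chain-head chain
    ... | A , refl = A , refl , proj₁ (Chain-walk (blame ◂ chain)) , Chain-Unique (blame ◂ chain)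

    _▸_ : ∀ {t s b K} → Chain t s K → Blame s b → Chain t b (K ++ [ flipped b ])
    stop            ▸ blame = blame ◂ stop
    (blame′ ◂ chain) ▸ blame = blame′ ◂ (chain ▸ blame)

    reversed-branch : ∀ {t s b K} → Chain t s K → Blame s b →
                      ∃ λ A → IsPath (flipped b ∷ flipped s ∷ A) × flipped t ∈ flipped s ∷ A
    reversed-branch {t} {s} {b} chain blame with Chain-last chain | Chain-head chain
    ... | K′ , refl | _ , K≡ =
      reverse K′ , subst IsPath reversed (Linked-reverse (Adj-sym {𝒞 = 𝒞}) (proj₁ (Chain-walk (chain ▸ blame)))
                                        , Unique-reverse (Chain-Unique (chain ▸ blame)))
                 , subst (flipped t ∈_) (reverse-++ K′ [ flipped s ]) (Any.reverse⁺ (subst (flipped t ∈_) (sym K≡) (here refl)))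
      where
      reversed : reverse ((K′ ++ [ flipped s ]) ++ [ flipped b ]) ≡ flipped b ∷ flipped s ∷ reverse K′
      reversed = trans (reverse-++ (K′ ++ [ flipped s ]) [ flipped b ]) (cong (flipped b ∷_) (reverse-++ K′ [ flipped s ]))

    same-ends⇒same-flip : ∀ {t f L t′ f′ L′} → Chain t f L → IsFirstFlip f → Chain t′ f′ L′ → IsFirstFlip f′ →
                          flipped t ≡ flipped t′ → flipped f ≡ flipped f′ → t ≡ t′
    same-ends⇒same-flip stop first stop first′ t≡t′ _ = firstFlip-unique first first′ t≡t′
    same-ends⇒same-flip stop _ (blame′ ◂ chain′) _ t≡t′ f≡f′ =
      ⊥-elim (Chain-never-returns blame′ chain′ (trans (sym t≡t′) f≡f′))
    same-ends⇒same-flip (blame ◂ chain) _ stop _ t≡t′ f≡f′ =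
      ⊥-elim (Chain-never-returns blame chain (trans t≡t′ (sym f≡f′)))
    same-ends⇒same-flip {t′ = t′} (_◂_ {r = r} blame chain) first (_◂_ {r = r′} blame′ chain′) first′ t≡t′ f≡f′
      with flipped r Fin.≟ flipped r′
    ... | yes r≡r′ =
      blame-injective blame (subst (Blame t′) (sym (same-ends⇒same-flip chain first chain′ first′ r≡r′ f≡f′)) blame′) t≡t′
    ... | no  r≢r′ with branch blame chain | branch blame′ chain′
    ...   | _ , refl , path | A′ , refl , path′ = ⊥-elim (
      branches-disjoint path (subst (λ u → IsPath (u ∷ flipped r′ ∷ A′)) (sym t≡t′) path′) r≢r′ (Chain-end chain)
                        (subst (_∈ flipped r′ ∷ A′) (sym f≡f′) (Chain-end chain′)))

    -- If r < s′, the windows in which the two blames forbid flips force s = t; but flip t makes the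
    -- interaction of its variable with u = flipped r unfavourable, and it stays so until s′.
    blame-order : ∀ {t r s′ s} → Blame t r → Blame s′ s → flipped s ≡ flipped t → flipped s′ ≡ flipped r → s ≤ t → s′ ≤ r
    blame-order {t} {r} {s′} {s} blame blame′ s≡t s′≡r s≤t = ≮⇒≥ r≮s′
      where
      r≮s′ : ¬ r < s′
      r≮s′ r<s′ with <-cmp s r
      ... | tri< s<r _ _ = Blame.t-unflipped blame′ (<⇒≤ s<r) r<s′ (sym s′≡r)
      ... | tri≈ _ refl _ = Blame.distinct blame s≡t
      ... | tri> _ _ r<s with m≤n⇒m<n∨m≡n s≤t
      ...   | inj₁ s<t  = Blame.t-unflipped blame (<⇒≤ r<s) s<t s≡t
      ...   | inj₂ refl = ℤ.<-asym favourable-at-s′ unfavourable-at-s′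
        where
        u = flipped s
        v = flipped r
        favourable-at-s′ : 0ℤ ℤ.< interactionAt u v s′
        favourable-at-s′ = subst (λ w → 0ℤ ℤ.< interactionAt u w s′) s′≡r
                             (subst (0ℤ ℤ.<_) (interactionAt-sym (flipped s′) u s′) (Blame.favourable blame′))
        unfavourable-at-s′ : interactionAt u v s′ ℤ.< 0ℤ
        unfavourable-at-s′ = subst (ℤ._< 0ℤ)
          (sym (trans (interactionAt-stable (Blame.r-unflipped blame′)
                                           (subst (λ w → Unflipped w (suc s) s′) s′≡r
                                                  (Unflipped-shrink (n≤1+n s) (Blame.t-unflipped blame′)))
                                           (Blame.r<t blame′) (<⇒≤ (Blame.t<m blame′)))
                      (interactionAt-flipˡ (Blame.t<m blame) refl (Blame.distinct blame))))
          (ℤ.neg-mono-< (Blame.favourable blame))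

    crossed-ends-impossible : ∀ {t f M t′ s K} → Chain t f M → IsFirstFlip f → Chain t′ s K → ¬ IsFirstFlip t′ →
                              flipped t′ ≡ flipped f → flipped s ≡ flipped t → s ≤ t → ⊥
    crossed-ends-impossible {t} {s = s} stop first chain′ not-first t′≡f s≡t s≤t with m≤n⇒m<n∨m≡n s≤t
    ... | inj₁ s<t  = proj₂ first s<t s≡t
    ... | inj₂ refl with chain′
    ...   | stop             = not-first first
    ...   | blame′ ◂ chain″  = Chain-never-returns blame′ chain″ t′≡f
    crossed-ends-impossible (_◂_ {r = r} blame chain) first chain′ not-first t′≡f s≡t s≤t with Chain-unsnoc chain′
    ... | inj₁ refl = Chain-never-returns blame chain (trans (sym s≡t) t′≡f)
    ... | inj₂ (s′ , _ , chain″ , blame′) with flipped s′ Fin.≟ flipped r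
    ...   | yes s′≡r = crossed-ends-impossible chain first chain″ not-first t′≡f s′≡r (blame-order blame blame′ s≡t s′≡r s≤t)
    ...   | no  s′≢r with branch blame chain | reversed-branch chain″ blame′
    ...     | _ , refl , path | A′ , path′ , t′∈ =
      branches-disjoint path (subst (λ u → IsPath (u ∷ flipped s′ ∷ A′)) s≡t path′) (s′≢r ∘ sym) (Chain-end chain)
                        (subst (_∈ flipped s′ ∷ A′) t′≡f t′∈)

    Chain-not-first : ∀ {t f L} → Chain t f L → flipped t ≢ flipped f → ¬ IsFirstFlip t
    Chain-not-first stop          t≢f = ⊥-elim (t≢f refl)
    Chain-not-first (blame ◂ _)   _   = Blame.not-first blame

    run-length-bound : m ≤ n C 2 + n
    run-length-bound = unorderedPair-injection⇒≤ (flipped ∘ toℕ) (flipped ∘ first) injective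
      where
      open UnorderedPairs using (unorderedPair-injection⇒≤; SamePair)
      first : Fin m → ℕ
      first t = Origin.first (origin (Fin.toℕ<n t))
      injective : ∀ s t → SamePair (flipped (toℕ s)) (flipped (first s)) (flipped (toℕ t)) (flipped (first t)) → s ≡ t
      injective s t same with origin (Fin.toℕ<n s) | origin (Fin.toℕ<n t)
      ... | record { chain = chain ; isFirst = isFirst } | record { chain = chain′ ; isFirst = isFirst′ } = by-cases same
        where
        by-cases : SamePair (flipped (toℕ s)) (flipped _) (flipped (toℕ t)) (flipped _) → s ≡ t
        by-cases (inj₁ (s≡t , f≡f′)) = Fin.toℕ-injective (same-ends⇒same-flip chain isFirst chain′ isFirst′ s≡t f≡f′)
        by-cases (inj₂ (s≡f′ , f≡t)) with flipped (toℕ s) Fin.≟ flipped (toℕ t)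
        ... | yes s≡t = by-cases (inj₁ (s≡t , trans f≡t (trans (sym s≡t) s≡f′)))
        ... | no  s≢t = ⊥-elim (crossed-ends-impossible chain isFirst chain′
                                  (Chain-not-first chain′ λ t≡f′ → s≢t (trans s≡f′ (sym t≡f′)))
                                  (sym f≡t) (sym s≡f′) (firstFlip-≤ isFirst′ s≡f′))

  module _ {n} {𝒞 : VCSP n} where

    pathPoint : ∀ {x xs} → Linked (FitnessEdge 𝒞) (x ∷ xs) → ℕ → Point n
    pathPoint {x} _         zero    = x
    pathPoint {x} [-]       (suc _) = x
    pathPoint     (_ ∷ lnk) (suc t) = pathPoint lnk t

    -- `filler` is only returned beyond the end of the path, where a run imposes nothing.
    pathFlipped : ∀ {x xs} → Fin n → Linked (FitnessEdge 𝒞) (x ∷ xs) → ℕ → Fin n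
    pathFlipped filler [-]                  _       = filler
    pathFlipped _      (((i , _) , _) ∷ _)  zero    = i
    pathFlipped filler (_ ∷ lnk)            (suc t) = pathFlipped filler lnk t

    pathRun : ∀ {x xs} → Fin n → Linked (FitnessEdge 𝒞) (x ∷ xs) → Run 𝒞 (length xs)
    pathRun filler lnk = record
      { point = pathPoint lnk ; flipped = pathFlipped filler lnk ; point-suc = point-suc lnk ; improves = improves lnk }
      where
      point-suc : ∀ {x xs} (lnk : Linked (FitnessEdge 𝒞) (x ∷ xs)) {t} → t < length xs →
                  pathPoint lnk (suc t) ≗ flipAt (pathPoint lnk t) (pathFlipped filler lnk t)
      point-suc ((differ , _) ∷ _)   {zero}  _         = differInOne⇒flipAt differ
      point-suc (_ ∷ lnk)             {suc t} (s≤s t<) = point-suc lnk t<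
      improves : ∀ {x xs} (lnk : Linked (FitnessEdge 𝒞) (x ∷ xs)) {t} → t < length xs →
                 fitness 𝒞 (pathPoint lnk t) ℤ.< fitness 𝒞 (pathPoint lnk (suc t))
      improves ((_ , better) ∷ _)  {zero}  _         = better
      improves (_ ∷ lnk)            {suc t} (s≤s t<) = improves lnk t<

open import Data.Nat using (_+_; _≤_; z≤n)
open import Data.Nat.Combinatorics using (_C_)
open Runs

theorem7 : (n : ℕ) (𝒞 : VCSP n) → ConstraintGraphIsTree 𝒞 →
    (x : Point n) (xs : List (Point n)) →
    Linked (FitnessEdge 𝒞) (x ∷ xs) →
    length xs ≤ (n C 2) + n
theorem7 n 𝒞 _            x []      _                          = z≤n
theorem7 n 𝒞 (_ , acyclic) x (_ ∷ _) lnk@(((i , _) , _) ∷ _) =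
  RunAnalysis.run-length-bound acyclic (pathRun {𝒞 = 𝒞} i lnk)
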